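{- Let $m,d\geq 1$. (1) If $d$ has a prime factor $p$ with $p\equiv 1\bmod m$, then $x^m-1$ divides $M_d(x)$. (2) For a prime $p$, $x^m-1$ minimally divides $M_p(x)$ if and only if $p\equiv 1\bmod m$.
   Context: $M_d(x)=\frac1d\sum_{e\mid d}\mu(e)x^{d/e}\in\mathbb{Q}[x]$ is the $d$th necklace polynomial, $\mu$ the Möbius function. $x^m-1$ minimally divides $M_d(x)$ if it divides $M_d(x)$ and does not divide $M_e(x)$ for any proper divisor $e$ of $d$. -}

module Defs where

open import Data.Nat as ℕ using (ℕ; zero; suc; _∸_)
open import Data.Nat.Divisibility using (_∣_; _∣?_)
open import Data.Nat.Primality using (Prime; prime?)
open import Data.Integer as ℤ using (ℤ)
open import Data.Rational as ℚ using (ℚ; 0ℚ; 1ℚ)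
open import Data.List using (List; []; _∷_; map; filter; upTo; length; replicate; _++_; [_]; foldr)
open import Data.Bool.ListAction using (any)
open import Data.Nat.Base using (nonZero)
open import Data.Bool using (if_then_else_)
open import Data.Product using (∃; _×_)
open import Relation.Nullary using (¬_)
open import Relation.Nullary.Decidable using (⌊_⌋; _×-dec_)
open import Relation.Binary.PropositionalEquality using (_≡_; _≢_)

-- Polynomials over ℚ as coefficient lists (constant term first).
-- Equality of polynomials is coefficientwise (trailing zeros irrelevant).

Poly : Set
Poly = List ℚ

coeff : Poly → ℕ → ℚ
coeff []       _       = 0ℚ
coeff (a ∷ p)  zero    = a
coeff (a ∷ p)  (suc n) = coeff p n

_+ᴾ_ : Poly → Poly → Poly
[]      +ᴾ q       = q
(a ∷ p) +ᴾ []      = a ∷ p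
(a ∷ p) +ᴾ (b ∷ q) = (a ℚ.+ b) ∷ (p +ᴾ q)

scaleᴾ : ℚ → Poly → Poly
scaleᴾ c p = map (c ℚ.*_) p

_*ᴾ_ : Poly → Poly → Poly
[]      *ᴾ q = []
(a ∷ p) *ᴾ q = scaleᴾ a q +ᴾ (0ℚ ∷ (p *ᴾ q))

monomial : ℚ → ℕ → Poly
monomial c n = replicate n 0ℚ ++ [ c ]

_≈ᴾ_ : Poly → Poly → Set
p ≈ᴾ q = ∀ n → coeff p n ≡ coeff q n

_∣ᴾ_ : Poly → Poly → Set
p ∣ᴾ q = ∃ λ r → (p *ᴾ r) ≈ᴾ q

xPowMinusOne : ℕ → Poly
xPowMinusOne m = monomial 1ℚ m +ᴾ [ ℚ.- 1ℚ ]

negOnePow : ℕ → ℤ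
negOnePow zero    = ℤ.+ 1
negOnePow (suc k) = ℤ.- negOnePow k

ω : ℕ → ℕ
ω n = length (filter (λ p → prime? p ×-dec p ∣? n) (upTo (suc n)))

-- μ(n) = 0 if k² ∣ n for some k ≥ 2, else (-1)^ω(n); μ(0) = 0 (unused)
μ : ℕ → ℤ
μ zero = ℤ.+ 0
μ n@(suc _) =
  if any (λ k → ⌊ (k ℕ.* k) ∣? n ⌋) (map (2 ℕ.+_) (upTo n))
  then ℤ.+ 0
  else negOnePow (ω n)

-- Necklace polynomial M_d(x) = (1/d) Σ_{e ∣ d} μ(e) x^{d/e}   (d ≥ 1;
-- M_0 is a junk value never used)

sumᴾ : List Poly → Poly
sumᴾ = foldr _+ᴾ_ []

-- the term μ(e) x^{d/e} for e = suc k, or 0 if e ∤ d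
necklaceTerm : ℕ → ℕ → Poly
necklaceTerm d k =
  if ⌊ suc k ∣? d ⌋ then monomial (μ (suc k) ℚ./ 1) (d ℕ./ suc k) else []

necklace : ℕ → Poly
necklace zero = []
necklace d@(suc n) =
  scaleᴾ ((ℤ.+ 1) ℚ./ d) (sumᴾ (map (necklaceTerm d) (upTo d)))

MinDivides : ℕ → ℕ → Set
MinDivides m d =
  xPowMinusOne m ∣ᴾ necklace d ×
  (∀ e → e ∣ d → e ≢ d → ¬ (xPowMinusOne m ∣ᴾ necklace e))

module Submission where

-- Part (1) is the cancellation argument of the paper, carried out modulo
-- x^m - 1.  Write d = d′·p; every divisor of d is either some e with p ∤ e,
-- or p·e with e ∣ d′.  For p ∤ e the summand μ(p·e) x^{d/(pe)} equals
-- -μ(e) x^{d/(pe)} and cancels μ(e) x^{d/e}, because d/e = p·(d/(pe)) and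
-- x^{a·p} ≡ x^a when p ≡ 1 (mod m); for p ∣ e it vanishes as p² ∣ p·e.
-- Part (2): M_p = (x^p - x)/p.  Pairing a polynomial with an m-periodic
-- weight sequence kills all multiples of x^m - 1; with the indicator of the
-- class of 1 mod m this shows p ≡ 1 (mod m), and with the constant weight it
-- shows that x^m - 1 does not divide M_1 = x, the only proper divisor case.

open import Defs
open import Algebra.Bundles using (CommutativeMonoid)
open import Data.Nat as ℕ using (ℕ; zero; suc; _+_; _*_; _∸_; _≤_; _<_; z≤n; s≤s)
open import Data.Nat.DivMod using (_/_; m*n/n≡m; n/1≡n; n/n≡1)
open import Data.Nat.Tactic.RingSolver using (solve-∀)
import Data.Nat.Properties as ℕP
open import Data.Rational as ℚ using (ℚ; 0ℚ; 1ℚ)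
import Data.Rational.Properties as ℚP
open import Data.Rational.Solver using (module +-*-Solver)
open import Data.Nat.Divisibility
  using (_∣_; divides; 1∣_; ∣m∣n⇒∣m+n; _∣?_; ∣m+n∣m⇒∣n; ∣-refl; ∣⇒≤; ∣-trans; n∣m*n; m∣m*n; *-pres-∣; *-cancelˡ-∣)
open import Data.List using ([]; _∷_; replicate; _++_; [_]; foldr; applyUpTo; map; upTo; filter; length)
open import Data.List.Properties using (upTo-∷ʳ; filter-++; length-++; map-upTo)
open import Data.List.Relation.Unary.Any using (Any)
open import Data.List.Relation.Unary.Any.Properties using (any⁺; any⁻; applyUpTo⁺; applyUpTo⁻)
open import Data.Bool using (Bool; true; false; T; if_then_else_)
open import Data.Bool.ListAction using (any)
open import Data.Integer as ℤ using (ℤ)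
open import Data.Nat.Primality using (Prime; prime?; euclidsLemma; prime⇒irreducible; prime⇒nonZero; ¬prime[1])
open import Data.Nat.Coprimality using (Coprime; coprime-divisor)
open import Data.Sum using (_⊎_; inj₁; inj₂; [_,_]′)
open import Relation.Unary using (Decidable)
open import Relation.Nullary.Decidable using (⌊_⌋; toWitness; fromWitness; _×-dec_)
open import Data.Product using (∃; _×_; _,_; proj₁; proj₂)
open import Data.Empty using (⊥-elim)
open import Function using (_∘_; id)
open import Function.Bundles using (_⇔_; mk⇔; Equivalence)
open import Relation.Nullary using (¬_; Dec; yes; no)
open import Relation.Binary.PropositionalEquality as ≡
  using (_≡_; _≢_; refl; sym; trans; cong; cong₂; subst; module ≡-Reasoning)

open +-*-Solver using (solve; _:=_; _:+_; _:*_; :-_; con)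

coeff-+ : ∀ p q n → coeff (p +ᴾ q) n ≡ coeff p n ℚ.+ coeff q n
coeff-+ []      q       n       = sym (ℚP.+-identityˡ _)
coeff-+ (a ∷ p) []      n       = sym (ℚP.+-identityʳ _)
coeff-+ (a ∷ p) (b ∷ q) zero    = refl
coeff-+ (a ∷ p) (b ∷ q) (suc n) = coeff-+ p q n

coeff-scale : ∀ c p n → coeff (scaleᴾ c p) n ≡ c ℚ.* coeff p n
coeff-scale c []      n       = sym (ℚP.*-zeroʳ c)
coeff-scale c (a ∷ p) zero    = refl
coeff-scale c (a ∷ p) (suc n) = coeff-scale c p n

x· : Poly → Poly
x· p = 0ℚ ∷ p

coeff-*ᴾ-∷ : ∀ a p q n → coeff ((a ∷ p) *ᴾ q) n ≡ a ℚ.* coeff q n ℚ.+ coeff (x· (p *ᴾ q)) n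
coeff-*ᴾ-∷ a p q n = trans (coeff-+ (scaleᴾ a q) (x· (p *ᴾ q)) n) (cong (ℚ._+ _) (coeff-scale a q n))

neg : Poly → Poly
neg = scaleᴾ (ℚ.- 1ℚ)

_-ᴾ_ : Poly → Poly → Poly
p -ᴾ q = p +ᴾ neg q

coeff-- : ∀ p q n → coeff (p -ᴾ q) n ≡ coeff p n ℚ.- coeff q n
coeff-- p q n = trans (coeff-+ p (neg q) n) (cong (coeff p n ℚ.+_) (trans (coeff-scale (ℚ.- 1ℚ) q n)
  (solve 1 (λ x → (:- con 1ℚ) :* x := :- x) refl (coeff q n))))

-- Coefficientwise equality, packaged as a record so that Agda can infer the
-- polynomials it relates (the unfolded type ∀ n → coeff p n ≡ coeff q n
-- does not determine p and q).

record _≃_ (p q : Poly) : Set where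
  constructor coeffwise
  field at : p ≈ᴾ q
open _≃_

≃-refl : ∀ {p} → p ≃ p
≃-refl = coeffwise λ n → refl

≃-sym : ∀ {p q} → p ≃ q → q ≃ p
≃-sym e = coeffwise λ n → sym (at e n)

≃-trans : ∀ {p q r} → p ≃ q → q ≃ r → p ≃ r
≃-trans e f = coeffwise λ n → trans (at e n) (at f n)

+ᴾ-cong : ∀ {p p′ q q′} → p ≃ p′ → q ≃ q′ → (p +ᴾ q) ≃ (p′ +ᴾ q′)
+ᴾ-cong {p} {p′} {q} {q′} e f = coeffwise λ n →
  trans (coeff-+ p q n) (trans (cong₂ ℚ._+_ (at e n) (at f n)) (sym (coeff-+ p′ q′ n)))

scaleᴾ-cong : ∀ c {p q} → p ≃ q → scaleᴾ c p ≃ scaleᴾ c q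
scaleᴾ-cong c {p} {q} e = coeffwise λ n →
  trans (coeff-scale c p n) (trans (cong (c ℚ.*_) (at e n)) (sym (coeff-scale c q n)))

x·-cong : ∀ {p q} → p ≃ q → x· p ≃ x· q
x·-cong e = coeffwise λ where
  zero    → refl
  (suc n) → at e n

+ᴾ-commutativeMonoid : CommutativeMonoid _ _
+ᴾ-commutativeMonoid = record
  { Carrier = Poly ; _≈_ = _≃_ ; _∙_ = _+ᴾ_ ; ε = []
  ; isCommutativeMonoid = record
    { isMonoid = record
      { isSemigroup = record
        { isMagma = record
          { isEquivalence = record { refl = ≃-refl ; sym = ≃-sym ; trans = ≃-trans }
          ; ∙-cong = +ᴾ-cong }
        ; assoc = λ p q r → coeffwise (assoc p q r) }
      ; identity = (λ p → ≃-refl)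
                 , (λ p → coeffwise λ n → trans (coeff-+ p [] n) (ℚP.+-identityʳ (coeff p n))) }
    ; comm = λ p q → coeffwise λ n →
        trans (coeff-+ p q n) (trans (ℚP.+-comm (coeff p n) (coeff q n)) (sym (coeff-+ q p n))) } }
  where
  assoc : ∀ p q r n → coeff ((p +ᴾ q) +ᴾ r) n ≡ coeff (p +ᴾ (q +ᴾ r)) n
  assoc p q r n
    rewrite coeff-+ (p +ᴾ q) r n | coeff-+ p q n | coeff-+ p (q +ᴾ r) n | coeff-+ q r n
    = ℚP.+-assoc (coeff p n) (coeff q n) (coeff r n)

x·-+ : ∀ p q n → coeff (x· (p +ᴾ q)) n ≡ coeff (x· p) n ℚ.+ coeff (x· q) n
x·-+ p q zero    = refl
x·-+ p q (suc n) = coeff-+ p q n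

x·-scale : ∀ c p n → coeff (x· (scaleᴾ c p)) n ≡ c ℚ.* coeff (x· p) n
x·-scale c p zero    = sym (ℚP.*-zeroʳ c)
x·-scale c p (suc n) = coeff-scale c p n

*ᴾ-zeroʳ : ∀ g → (g *ᴾ []) ≃ []
*ᴾ-zeroʳ g = coeffwise (go g)
  where
  go : ∀ g → (g *ᴾ []) ≈ᴾ []
  go []      n       = refl
  go (a ∷ g) zero    = refl
  go (a ∷ g) (suc n) = go g n

*ᴾ-distribˡ-+ : ∀ g r s → (g *ᴾ (r +ᴾ s)) ≃ ((g *ᴾ r) +ᴾ (g *ᴾ s))
*ᴾ-distribˡ-+ []      r s = ≃-refl
*ᴾ-distribˡ-+ (a ∷ g) r s = coeffwise λ n → begin
  coeff ((a ∷ g) *ᴾ (r +ᴾ s)) n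
    ≡⟨ coeff-*ᴾ-∷ a g (r +ᴾ s) n ⟩
  a ℚ.* coeff (r +ᴾ s) n ℚ.+ coeff (x· (g *ᴾ (r +ᴾ s))) n
    ≡⟨ cong₂ (λ u v → a ℚ.* u ℚ.+ v) (coeff-+ r s n)
             (trans (at (x·-cong (*ᴾ-distribˡ-+ g r s)) n) (x·-+ (g *ᴾ r) (g *ᴾ s) n)) ⟩
  a ℚ.* (coeff r n ℚ.+ coeff s n) ℚ.+ (coeff (x· (g *ᴾ r)) n ℚ.+ coeff (x· (g *ᴾ s)) n)
    ≡⟨ solve 5 (λ a u v X Y → a :* (u :+ v) :+ (X :+ Y) := (a :* u :+ X) :+ (a :* v :+ Y))
             refl a (coeff r n) (coeff s n) (coeff (x· (g *ᴾ r)) n) (coeff (x· (g *ᴾ s)) n) ⟩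
  (a ℚ.* coeff r n ℚ.+ coeff (x· (g *ᴾ r)) n) ℚ.+ (a ℚ.* coeff s n ℚ.+ coeff (x· (g *ᴾ s)) n)
    ≡⟨ sym (cong₂ ℚ._+_ (coeff-*ᴾ-∷ a g r n) (coeff-*ᴾ-∷ a g s n)) ⟩
  coeff ((a ∷ g) *ᴾ r) n ℚ.+ coeff ((a ∷ g) *ᴾ s) n
    ≡⟨ sym (coeff-+ ((a ∷ g) *ᴾ r) ((a ∷ g) *ᴾ s) n) ⟩
  coeff (((a ∷ g) *ᴾ r) +ᴾ ((a ∷ g) *ᴾ s)) n ∎
  where open ≡-Reasoning

*ᴾ-scaleʳ : ∀ g c r → (g *ᴾ scaleᴾ c r) ≃ scaleᴾ c (g *ᴾ r)
*ᴾ-scaleʳ []      c r = ≃-refl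
*ᴾ-scaleʳ (a ∷ g) c r = coeffwise λ n → begin
  coeff ((a ∷ g) *ᴾ scaleᴾ c r) n
    ≡⟨ coeff-*ᴾ-∷ a g (scaleᴾ c r) n ⟩
  a ℚ.* coeff (scaleᴾ c r) n ℚ.+ coeff (x· (g *ᴾ scaleᴾ c r)) n
    ≡⟨ cong₂ (λ u v → a ℚ.* u ℚ.+ v) (coeff-scale c r n)
             (trans (at (x·-cong (*ᴾ-scaleʳ g c r)) n) (x·-scale c (g *ᴾ r) n)) ⟩
  a ℚ.* (c ℚ.* coeff r n) ℚ.+ c ℚ.* coeff (x· (g *ᴾ r)) n
    ≡⟨ solve 4 (λ a c u X → a :* (c :* u) :+ c :* X := c :* (a :* u :+ X))
             refl a c (coeff r n) (coeff (x· (g *ᴾ r)) n) ⟩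
  c ℚ.* (a ℚ.* coeff r n ℚ.+ coeff (x· (g *ᴾ r)) n)
    ≡⟨ cong (c ℚ.*_) (sym (coeff-*ᴾ-∷ a g r n)) ⟩
  c ℚ.* coeff ((a ∷ g) *ᴾ r) n
    ≡⟨ sym (coeff-scale c ((a ∷ g) *ᴾ r) n) ⟩
  coeff (scaleᴾ c ((a ∷ g) *ᴾ r)) n ∎
  where open ≡-Reasoning

scaleᴾ-distrib-difference : ∀ c f h → scaleᴾ c (f -ᴾ h) ≃ (scaleᴾ c f -ᴾ scaleᴾ c h)
scaleᴾ-distrib-difference c f h = coeffwise λ n → begin
  coeff (scaleᴾ c (f -ᴾ h)) n             ≡⟨ trans (coeff-scale c (f -ᴾ h) n) (cong (c ℚ.*_) (coeff-- f h n)) ⟩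
  c ℚ.* (coeff f n ℚ.- coeff h n)
    ≡⟨ solve 3 (λ c u v → c :* (u :+ :- v) := c :* u :+ :- (c :* v)) refl c (coeff f n) (coeff h n) ⟩
  c ℚ.* coeff f n ℚ.- c ℚ.* coeff h n
    ≡⟨ sym (trans (coeff-- (scaleᴾ c f) (scaleᴾ c h) n) (cong₂ ℚ._-_ (coeff-scale c f n) (coeff-scale c h n))) ⟩
  coeff (scaleᴾ c f -ᴾ scaleᴾ c h) n       ∎
  where open ≡-Reasoning

neg-+ᴾ-cancel : ∀ f → (neg f +ᴾ f) ≃ []
neg-+ᴾ-cancel f = coeffwise λ n → begin
  coeff (neg f +ᴾ f) n                       ≡⟨ trans (coeff-+ (neg f) f n) (cong (ℚ._+ coeff f n) (coeff-scale (ℚ.- 1ℚ) f n)) ⟩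
  ℚ.- 1ℚ ℚ.* coeff f n ℚ.+ coeff f n         ≡⟨ solve 1 (λ u → (:- con 1ℚ) :* u :+ u := con 0ℚ) refl (coeff f n) ⟩
  0ℚ                                         ∎
  where open ≡-Reasoning

module Modulo (g : Poly) where

  infix 4 _≋_
  infix 1 _by_

  record _≋_ (f h : Poly) : Set where
    constructor _by_
    field
      quotient : Poly
      spec     : (g *ᴾ quotient) ≃ (f -ᴾ h)

  ≃⇒≋ : ∀ {f h} → f ≃ h → f ≋ h
  ≃⇒≋ {f} {h} f≃h = [] by coeffwise λ n → begin
    coeff (g *ᴾ []) n         ≡⟨ at (*ᴾ-zeroʳ g) n ⟩
    0ℚ                        ≡⟨ sym (ℚP.+-inverseʳ (coeff h n)) ⟩
    coeff h n ℚ.- coeff h n   ≡⟨ cong (ℚ._- coeff h n) (sym (at f≃h n)) ⟩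
    coeff f n ℚ.- coeff h n   ≡⟨ sym (coeff-- f h n) ⟩
    coeff (f -ᴾ h) n          ∎
    where open ≡-Reasoning

  ≋-scale : ∀ c {f h} → f ≋ h → scaleᴾ c f ≋ scaleᴾ c h
  ≋-scale c {f} {h} (q by gq≃f-h) =
    scaleᴾ c q by ≃-trans (*ᴾ-scaleʳ g c q) (≃-trans (scaleᴾ-cong c gq≃f-h) (scaleᴾ-distrib-difference c f h))

  ≋-sym : ∀ {f h} → f ≋ h → h ≋ f
  ≋-sym {f} {h} (q by gq≃f-h) = neg q by ≃-trans (*ᴾ-scaleʳ g (ℚ.- 1ℚ) q)
    (≃-trans (scaleᴾ-cong (ℚ.- 1ℚ) gq≃f-h) (coeffwise λ n → begin
      coeff (neg (f -ᴾ h)) n          ≡⟨ coeff-scale (ℚ.- 1ℚ) (f -ᴾ h) n ⟩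
      ℚ.- 1ℚ ℚ.* coeff (f -ᴾ h) n     ≡⟨ cong (ℚ.- 1ℚ ℚ.*_) (coeff-- f h n) ⟩
      ℚ.- 1ℚ ℚ.* (coeff f n ℚ.- coeff h n)
        ≡⟨ solve 2 (λ u v → (:- con 1ℚ) :* (u :+ :- v) := v :+ :- u) refl (coeff f n) (coeff h n) ⟩
      coeff h n ℚ.- coeff f n         ≡⟨ sym (coeff-- h f n) ⟩
      coeff (h -ᴾ f) n                ∎))
    where open ≡-Reasoning

  ≋-trans : ∀ {f h k} → f ≋ h → h ≋ k → f ≋ k
  ≋-trans {f} {h} {k} (q by gq≃f-h) (q′ by gq′≃h-k) = q +ᴾ q′ by ≃-trans (*ᴾ-distribˡ-+ g q q′)
    (≃-trans (+ᴾ-cong gq≃f-h gq′≃h-k) (coeffwise λ n → begin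
      coeff ((f -ᴾ h) +ᴾ (h -ᴾ k)) n
        ≡⟨ trans (coeff-+ (f -ᴾ h) (h -ᴾ k) n) (cong₂ ℚ._+_ (coeff-- f h n) (coeff-- h k n)) ⟩
      (coeff f n ℚ.- coeff h n) ℚ.+ (coeff h n ℚ.- coeff k n)
        ≡⟨ solve 3 (λ u v w → (u :+ :- v) :+ (v :+ :- w) := u :+ :- w)
                 refl (coeff f n) (coeff h n) (coeff k n) ⟩
      coeff f n ℚ.- coeff k n   ≡⟨ sym (coeff-- f k n) ⟩
      coeff (f -ᴾ k) n          ∎))
    where open ≡-Reasoning

  ≋-+ : ∀ {f f′ h h′} → f ≋ f′ → h ≋ h′ → (f +ᴾ h) ≋ (f′ +ᴾ h′)
  ≋-+ {f} {f′} {h} {h′} (q by gq≃f-f′) (q′ by gq′≃h-h′) = q +ᴾ q′ by ≃-trans (*ᴾ-distribˡ-+ g q q′)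
    (≃-trans (+ᴾ-cong gq≃f-f′ gq′≃h-h′) (coeffwise λ n → begin
      coeff ((f -ᴾ f′) +ᴾ (h -ᴾ h′)) n
        ≡⟨ trans (coeff-+ (f -ᴾ f′) (h -ᴾ h′) n) (cong₂ ℚ._+_ (coeff-- f f′ n) (coeff-- h h′ n)) ⟩
      (coeff f n ℚ.- coeff f′ n) ℚ.+ (coeff h n ℚ.- coeff h′ n)
        ≡⟨ solve 4 (λ a a′ b b′ → (a :+ :- a′) :+ (b :+ :- b′) := (a :+ b) :+ :- (a′ :+ b′))
                 refl (coeff f n) (coeff f′ n) (coeff h n) (coeff h′ n) ⟩
      (coeff f n ℚ.+ coeff h n) ℚ.- (coeff f′ n ℚ.+ coeff h′ n)
        ≡⟨ sym (trans (coeff-- (f +ᴾ h) (f′ +ᴾ h′) n)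
                      (cong₂ ℚ._-_ (coeff-+ f h n) (coeff-+ f′ h′ n))) ⟩
      coeff ((f +ᴾ h) -ᴾ (f′ +ᴾ h′)) n ∎))
    where open ≡-Reasoning

  ≋-zero⇒∣ᴾ : ∀ {f} → f ≋ [] → g ∣ᴾ f
  ≋-zero⇒∣ᴾ {f} (q by gq≃f-0) =
    q , at (≃-trans {r = f} gq≃f-0 (coeffwise λ n → trans (coeff-- f [] n) (ℚP.+-identityʳ (coeff f n))))

  ≋-commutativeMonoid : CommutativeMonoid _ _
  ≋-commutativeMonoid = record
    { Carrier = Poly ; _≈_ = _≋_ ; _∙_ = _+ᴾ_ ; ε = []
    ; isCommutativeMonoid = record
      { isMonoid = record
        { isSemigroup = record
          { isMagma = record
            { isEquivalence = record { refl = ≃⇒≋ ≃-refl ; sym = ≋-sym ; trans = ≋-trans }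
            ; ∙-cong = ≋-+ }
          ; assoc = λ p q r → ≃⇒≋ (P.assoc p q r) }
        ; identity = (λ p → ≃⇒≋ (P.identityˡ p)) , (λ p → ≃⇒≋ (P.identityʳ p)) }
      ; comm = λ p q → ≃⇒≋ (P.comm p q) } }
    where module P = CommutativeMonoid +ᴾ-commutativeMonoid

shiftᴾ : ℕ → Poly → Poly
shiftᴾ k r = replicate k 0ℚ ++ r

shiftᴾ-monomial : ∀ k c a → shiftᴾ k (monomial c a) ≡ monomial c (k + a)
shiftᴾ-monomial zero    c a = refl
shiftᴾ-monomial (suc k) c a = cong (0ℚ ∷_) (shiftᴾ-monomial k c a)

coeff-x·[] : ∀ n → coeff (x· []) n ≡ 0ℚ
coeff-x·[] zero    = refl
coeff-x·[] (suc n) = refl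

*ᴾ-distribʳ-+ : ∀ p q r → ((p +ᴾ q) *ᴾ r) ≃ ((p *ᴾ r) +ᴾ (q *ᴾ r))
*ᴾ-distribʳ-+ []      q       r = ≃-refl
*ᴾ-distribʳ-+ (a ∷ p) []      r = ≃-sym (CommutativeMonoid.identityʳ +ᴾ-commutativeMonoid _)
*ᴾ-distribʳ-+ (a ∷ p) (b ∷ q) r = coeffwise λ n → begin
  coeff (((a ℚ.+ b) ∷ (p +ᴾ q)) *ᴾ r) n
    ≡⟨ coeff-*ᴾ-∷ (a ℚ.+ b) (p +ᴾ q) r n ⟩
  (a ℚ.+ b) ℚ.* coeff r n ℚ.+ coeff (x· ((p +ᴾ q) *ᴾ r)) n
    ≡⟨ cong ((a ℚ.+ b) ℚ.* coeff r n ℚ.+_)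
         (trans (at (x·-cong (*ᴾ-distribʳ-+ p q r)) n) (x·-+ (p *ᴾ r) (q *ᴾ r) n)) ⟩
  (a ℚ.+ b) ℚ.* coeff r n ℚ.+ (coeff (x· (p *ᴾ r)) n ℚ.+ coeff (x· (q *ᴾ r)) n)
    ≡⟨ solve 5 (λ a b u X Y → (a :+ b) :* u :+ (X :+ Y) := (a :* u :+ X) :+ (b :* u :+ Y))
             refl a b (coeff r n) (coeff (x· (p *ᴾ r)) n) (coeff (x· (q *ᴾ r)) n) ⟩
  (a ℚ.* coeff r n ℚ.+ coeff (x· (p *ᴾ r)) n) ℚ.+ (b ℚ.* coeff r n ℚ.+ coeff (x· (q *ᴾ r)) n)
    ≡⟨ sym (trans (coeff-+ ((a ∷ p) *ᴾ r) ((b ∷ q) *ᴾ r) n)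
                  (cong₂ ℚ._+_ (coeff-*ᴾ-∷ a p r n) (coeff-*ᴾ-∷ b q r n))) ⟩
  coeff (((a ∷ p) *ᴾ r) +ᴾ ((b ∷ q) *ᴾ r)) n ∎
  where open ≡-Reasoning

monomial-*ᴾ : ∀ k r → (monomial 1ℚ k *ᴾ r) ≃ shiftᴾ k r
monomial-*ᴾ zero r = coeffwise λ n → begin
  coeff ([ 1ℚ ] *ᴾ r) n                       ≡⟨ coeff-*ᴾ-∷ 1ℚ [] r n ⟩
  1ℚ ℚ.* coeff r n ℚ.+ coeff (x· []) n       ≡⟨ cong (1ℚ ℚ.* coeff r n ℚ.+_) (coeff-x·[] n) ⟩
  1ℚ ℚ.* coeff r n ℚ.+ 0ℚ                    ≡⟨ solve 1 (λ u → con 1ℚ :* u :+ con 0ℚ := u) refl (coeff r n) ⟩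
  coeff r n                                   ∎
  where open ≡-Reasoning
monomial-*ᴾ (suc k) r = coeffwise λ n → begin
  coeff (x· (monomial 1ℚ k) *ᴾ r) n
    ≡⟨ coeff-*ᴾ-∷ 0ℚ (monomial 1ℚ k) r n ⟩
  0ℚ ℚ.* coeff r n ℚ.+ coeff (x· (monomial 1ℚ k *ᴾ r)) n
    ≡⟨ cong (0ℚ ℚ.* coeff r n ℚ.+_) (at (x·-cong (monomial-*ᴾ k r)) n) ⟩
  0ℚ ℚ.* coeff r n ℚ.+ coeff (shiftᴾ (suc k) r) n
    ≡⟨ solve 2 (λ u v → con 0ℚ :* u :+ v := v) refl (coeff r n) (coeff (shiftᴾ (suc k) r) n) ⟩
  coeff (shiftᴾ (suc k) r) n ∎
  where open ≡-Reasoning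

xPowMinusOne-*ᴾ : ∀ m r → (xPowMinusOne m *ᴾ r) ≃ (shiftᴾ m r -ᴾ r)
xPowMinusOne-*ᴾ m r = ≃-trans (*ᴾ-distribʳ-+ (monomial 1ℚ m) [ ℚ.- 1ℚ ] r)
  (+ᴾ-cong (monomial-*ᴾ m r) (coeffwise λ n →
    trans (coeff-*ᴾ-∷ (ℚ.- 1ℚ) [] r n)
          (trans (cong (ℚ.- 1ℚ ℚ.* coeff r n ℚ.+_) (coeff-x·[] n))
                 (trans (ℚP.+-identityʳ _) (sym (coeff-scale (ℚ.- 1ℚ) r n))))))

module ModuloXPowMinusOne (m : ℕ) where
  open Modulo (xPowMinusOne m) public

  monomial-shift-≋ : ∀ c b → monomial c (m + b) ≋ monomial c b
  monomial-shift-≋ c b = monomial c b by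
    subst (λ f → (xPowMinusOne m *ᴾ monomial c b) ≃ (f -ᴾ monomial c b))
          (shiftᴾ-monomial m c b) (xPowMinusOne-*ᴾ m (monomial c b))

  monomial-period-≋ : ∀ c a t → monomial c (a + m * t) ≋ monomial c a
  monomial-period-≋ c a zero
    rewrite ℕP.*-zeroʳ m | ℕP.+-identityʳ a = ≃⇒≋ ≃-refl
  monomial-period-≋ c a (suc t) =
    subst (λ b → monomial c b ≋ monomial c a) (sym a+m[1+t]≡m+[a+mt])
      (≋-trans (monomial-shift-≋ c (a + m * t)) (monomial-period-≋ c a t))
    where
    a+m[1+t]≡m+[a+mt] : a + m * suc t ≡ m + (a + m * t)
    a+m[1+t]≡m+[a+mt] = begin
      a + m * suc t     ≡⟨ cong (a +_) (ℕP.*-suc m t) ⟩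
      a + (m + m * t)   ≡⟨ ℕP.+-comm a (m + m * t) ⟩
      (m + m * t) + a   ≡⟨ ℕP.+-assoc m (m * t) a ⟩
      m + (m * t + a)   ≡⟨ cong (m +_) (ℕP.+-comm (m * t) a) ⟩
      m + (a + m * t)   ∎
      where open ≡-Reasoning

-- Finite sums Σ_{k<n} f k in a commutative monoid, in the form in which
-- necklace polynomials are defined: a right fold over applyUpTo f n.

module RangeSum {c ℓ} (M : CommutativeMonoid c ℓ) where
  open CommutativeMonoid M renaming (refl to ≈-refl; sym to ≈-sym; trans to ≈-trans)
  open import Relation.Binary.Reasoning.Setoid setoid

  Σ< : ℕ → (ℕ → Carrier) → Carrier
  Σ< n f = foldr _∙_ ε (applyUpTo f n)

  Σ<-cong : ∀ n {f h} → (∀ k → k < n → f k ≈ h k) → Σ< n f ≈ Σ< n h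
  Σ<-cong zero    f≈h = ≈-refl
  Σ<-cong (suc n) f≈h =
    ∙-cong (f≈h 0 (s≤s z≤n)) (Σ<-cong n (λ k k<n → f≈h (suc k) (s≤s k<n)))

  Σ<-ε : ∀ n {f} → (∀ k → k < n → f k ≈ ε) → Σ< n f ≈ ε
  Σ<-ε n {f} f≈ε = ≈-trans (Σ<-cong n f≈ε) (go n)
    where
    go : ∀ n → Σ< n (λ _ → ε) ≈ ε
    go zero    = ≈-refl
    go (suc n) = ≈-trans (identityˡ _) (go n)

  Σ<-∙ : ∀ n f h → Σ< n (λ k → f k ∙ h k) ≈ Σ< n f ∙ Σ< n h
  Σ<-∙ zero    f h = ≈-sym (identityˡ ε)
  Σ<-∙ (suc n) f h = begin
    (f 0 ∙ h 0) ∙ Σ< n (λ k → f (suc k) ∙ h (suc k))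
      ≈⟨ ∙-congˡ (Σ<-∙ n (λ k → f (suc k)) (λ k → h (suc k))) ⟩
    (f 0 ∙ h 0) ∙ (Σ< n (λ k → f (suc k)) ∙ Σ< n (λ k → h (suc k)))
      ≈⟨ medial (f 0) (h 0) _ _ ⟩
    (f 0 ∙ Σ< n (λ k → f (suc k))) ∙ (h 0 ∙ Σ< n (λ k → h (suc k))) ∎
    where
    medial : ∀ a b x y → (a ∙ b) ∙ (x ∙ y) ≈ (a ∙ x) ∙ (b ∙ y)
    medial a b x y = begin
      (a ∙ b) ∙ (x ∙ y)   ≈⟨ assoc a b (x ∙ y) ⟩
      a ∙ (b ∙ (x ∙ y))   ≈⟨ ∙-congˡ (≈-sym (assoc b x y)) ⟩
      a ∙ ((b ∙ x) ∙ y)   ≈⟨ ∙-congˡ (∙-congʳ (comm b x)) ⟩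
      a ∙ ((x ∙ b) ∙ y)   ≈⟨ ∙-congˡ (assoc x b y) ⟩
      a ∙ (x ∙ (b ∙ y))   ≈⟨ ≈-sym (assoc a x (b ∙ y)) ⟩
      (a ∙ x) ∙ (b ∙ y)   ∎

  Σ<-+ : ∀ a b f → Σ< (a + b) f ≈ Σ< a f ∙ Σ< b (λ k → f (a + k))
  Σ<-+ zero    b f = ≈-sym (identityˡ _)
  Σ<-+ (suc a) b f = ≈-trans (∙-congˡ (Σ<-+ a b (λ k → f (suc k)))) (≈-sym (assoc _ _ _))

  Σ<-last : ∀ n f → Σ< (suc n) f ≈ Σ< n f ∙ f n
  Σ<-last zero    f = comm (f 0) ε
  Σ<-last (suc n) f = ≈-trans (∙-congˡ (Σ<-last n (λ k → f (suc k)))) (≈-sym (assoc _ _ _))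

  Σ<-truncate : ∀ {a n} f → a ≤ n → (∀ k → a ≤ k → f k ≈ ε) → Σ< n f ≈ Σ< a f
  Σ<-truncate {a} {n} f a≤n vanish = begin
    Σ< n f                                          ≡⟨ ≡.cong (λ n → Σ< n f) (≡.sym (ℕP.m+[n∸m]≡n a≤n)) ⟩
    Σ< (a + (n ∸ a)) f                              ≈⟨ Σ<-+ a (n ∸ a) f ⟩
    Σ< a f ∙ Σ< (n ∸ a) (λ k → f (a + k))           ≈⟨ ∙-congˡ (Σ<-ε (n ∸ a) (λ k _ → vanish (a + k) (ℕP.m≤m+n a k))) ⟩
    Σ< a f ∙ ε                                      ≈⟨ identityʳ _ ⟩
    Σ< a f                                          ∎

  when : ∀ {a} {A : Set a} → Dec A → Carrier → Carrier
  when (yes _) x = x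
  when (no _)  _ = ε

  unless : ∀ {a} {A : Set a} → Dec A → Carrier → Carrier
  unless (yes _) _ = ε
  unless (no _)  x = x

  when-yes : ∀ {a} {A : Set a} (d : Dec A) {x} → A → when d x ≡ x
  when-yes (yes _) _  = ≡.refl
  when-yes (no ¬a) a  = ⊥-elim (¬a a)

  when-no : ∀ {a} {A : Set a} (d : Dec A) {x} → ¬ A → when d x ≡ ε
  when-no (yes a) ¬a = ⊥-elim (¬a a)
  when-no (no _)  _  = ≡.refl

  unless-yes : ∀ {a} {A : Set a} (d : Dec A) {x} → A → unless d x ≡ ε
  unless-yes (yes _) _  = ≡.refl
  unless-yes (no ¬a) a  = ⊥-elim (¬a a)

  unless-no : ∀ {a} {A : Set a} (d : Dec A) {x} → ¬ A → unless d x ≡ x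
  unless-no (yes a) ¬a = ⊥-elim (¬a a)
  unless-no (no _)  _  = ≡.refl

  Σ<-partition : ∀ {p} {P : ℕ → Set p} (P? : ∀ k → Dec (P k)) n f →
    Σ< n f ≈ Σ< n (λ k → when (P? k) (f k)) ∙ Σ< n (λ k → unless (P? k) (f k))
  Σ<-partition P? n f = ≈-trans (Σ<-cong n (λ k _ → split (P? k))) (Σ<-∙ n _ _)
    where
    split : ∀ {A : Set _} (d : Dec A) {x} → x ≈ when d x ∙ unless d x
    split (yes _) = ≈-sym (identityʳ _)
    split (no _)  = ≈-sym (identityˡ _)

  Σ<-multiples : ∀ q N f → (∀ k → ¬ (suc q ∣ suc k) → f k ≈ ε) →
    Σ< (N * suc q) f ≈ Σ< N (λ j → f (j * suc q + q))
  Σ<-multiples q zero    f vanish = ≈-refl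
  Σ<-multiples q (suc N) f vanish = begin
    Σ< (suc q + N * suc q) f
      ≈⟨ Σ<-+ (suc q) (N * suc q) f ⟩
    Σ< (suc q) f ∙ Σ< (N * suc q) (λ k → f (suc q + k))
      ≈⟨ ∙-cong first-block (Σ<-multiples q N (λ k → f (suc q + k)) (λ k → vanish (suc q + k) ∘ later k)) ⟩
    f q ∙ Σ< N (λ j → f (suc q + (j * suc q + q)))
      ≈⟨ ∙-congˡ (Σ<-cong N (λ j _ → reflexive (≡.cong f (≡.sym (ℕP.+-assoc (suc q) (j * suc q) q))))) ⟩
    f q ∙ Σ< N (λ j → f (suc j * suc q + q)) ∎
    where
    later : ∀ k → ¬ (suc q ∣ suc k) → ¬ (suc q ∣ suc (suc q + k))
    later k ¬p∣k+1 p∣ = ¬p∣k+1 (∣m+n∣m⇒∣n (≡.subst (suc q ∣_) (≡.sym (ℕP.+-suc (suc q) k)) p∣) ∣-refl)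
    first-block : Σ< (suc q) f ≈ f q
    first-block = begin
      Σ< (suc q) f     ≈⟨ Σ<-last q f ⟩
      Σ< q f ∙ f q     ≈⟨ ∙-congʳ (Σ<-ε q (λ k k<q → vanish k (λ p∣ → ℕP.<⇒≱ (s≤s k<q) (∣⇒≤ p∣)))) ⟩
      ε ∙ f q          ≈⟨ identityˡ (f q) ⟩
      f q              ∎

count : ∀ {P : ℕ → Set} → Decidable P → ℕ → ℕ
count P? N = length (filter P? (upTo N))

indicator : ∀ {P : ℕ → Set} → Decidable P → ℕ → ℕ
indicator P? N = length (filter P? [ N ])

indicator-yes : ∀ {P : ℕ → Set} (P? : Decidable P) {N} → P N → indicator P? N ≡ 1
indicator-yes P? {N} pN with P? N
... | yes _  = refl
... | no ¬pN = ⊥-elim (¬pN pN)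

indicator-no : ∀ {P : ℕ → Set} (P? : Decidable P) {N} → ¬ P N → indicator P? N ≡ 0
indicator-no P? {N} ¬pN with P? N
... | yes pN = ⊥-elim (¬pN pN)
... | no _   = refl

indicator-cong : ∀ {P Q : ℕ → Set} (P? : Decidable P) (Q? : Decidable Q) {N} →
  P N ⇔ Q N → indicator P? N ≡ indicator Q? N
indicator-cong P? Q? {N} P⇔Q with P? N
... | yes pN = sym (indicator-yes Q? (Equivalence.to P⇔Q pN))
... | no ¬pN = sym (indicator-no Q? (¬pN ∘ Equivalence.from P⇔Q))

count-suc : ∀ {P : ℕ → Set} (P? : Decidable P) N → count P? (suc N) ≡ count P? N + indicator P? N
count-suc P? N = begin
  length (filter P? (upTo (suc N)))               ≡⟨ cong (length ∘ filter P?) (sym (upTo-∷ʳ N)) ⟩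
  length (filter P? (upTo N ++ [ N ]))            ≡⟨ cong length (filter-++ P? (upTo N) [ N ]) ⟩
  length (filter P? (upTo N) ++ filter P? [ N ])  ≡⟨ length-++ (filter P? (upTo N)) ⟩
  count P? N + indicator P? N                     ∎
  where open ≡-Reasoning

count-cong : ∀ {P Q : ℕ → Set} (P? : Decidable P) (Q? : Decidable Q) N →
  (∀ k → k < N → P k ⇔ Q k) → count P? N ≡ count Q? N
count-cong P? Q? zero    P⇔Q = refl
count-cong P? Q? (suc N) P⇔Q
  rewrite count-suc P? N | count-suc Q? N
        | count-cong P? Q? N (λ k k<N → P⇔Q k (ℕP.m<n⇒m<1+n k<N))
        | indicator-cong P? Q? (P⇔Q N ℕP.≤-refl) = refl

drop-⊎ : ∀ {X A B : Set} → ¬ A → X ⇔ (A ⊎ B) → X ⇔ B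
drop-⊎ ¬a X⇔A⊎B = mk⇔ (λ x → [ (λ a → ⊥-elim (¬a a)) , id ]′ (Equivalence.to X⇔A⊎B x))
                      (Equivalence.from X⇔A⊎B ∘ inj₂)

count-insert : ∀ {P Q : ℕ → Set} (P? : Decidable P) (Q? : Decidable Q) a N →
  (∀ k → k < N → P k ⇔ (k ≡ a ⊎ Q k)) → ¬ Q a → a < N → count P? N ≡ suc (count Q? N)
count-insert P? Q? a (suc N) P⇔a∨Q ¬Qa a<1+N
  rewrite count-suc P? N | count-suc Q? N with a ℕP.≟ N
... | yes refl
  rewrite count-cong P? Q? N (λ k k<N → drop-⊎ (ℕP.<⇒≢ k<N) (P⇔a∨Q k (ℕP.m<n⇒m<1+n k<N)))
        | indicator-yes P? (Equivalence.from (P⇔a∨Q a ℕP.≤-refl) (inj₁ refl))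
        | indicator-no Q? ¬Qa
  = trans (ℕP.+-comm (count Q? N) 1) (cong suc (sym (ℕP.+-identityʳ (count Q? N))))
... | no a≢N
  rewrite count-insert P? Q? a N (λ k k<N → P⇔a∨Q k (ℕP.m<n⇒m<1+n k<N)) ¬Qa
                       (ℕP.≤∧≢⇒< (ℕP.≤-pred a<1+N) a≢N)
        | indicator-cong P? Q? (drop-⊎ (a≢N ∘ sym) (P⇔a∨Q N ℕP.≤-refl))
  = refl

count-beyond : ∀ {P : ℕ → Set} (P? : Decidable P) {N} M → N ≤ M →
  (∀ k → N ≤ k → ¬ P k) → count P? M ≡ count P? N
count-beyond P? {zero}  zero    z≤n _ = refl
count-beyond P? {N}     (suc M) N≤1+M ¬P with ℕP.m≤n⇒m<n∨m≡n N≤1+M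
... | inj₂ refl = refl
... | inj₁ N<1+M
  rewrite count-suc P? M | indicator-no P? (¬P M (ℕP.≤-pred N<1+M))
        | count-beyond P? M (ℕP.≤-pred N<1+M) ¬P = ℕP.+-identityʳ (count P? N)

squareful : ℕ → Bool
squareful n = any (λ k → ⌊ k * k ∣? n ⌋) (map (2 +_) (upTo n))

μ-unfold : ∀ n .{{_ : ℕ.NonZero n}} → μ n ≡ (if squareful n then ℤ.+ 0 else negOnePow (ω n))
μ-unfold (suc n) = refl

HasSquareFactor : ℕ → Set
HasSquareFactor n = ∃ λ k → 2 ≤ k × k * k ∣ n

squareful-sound : ∀ n → T (squareful n) → HasSquareFactor n
squareful-sound n t
  with i , _ , ii∣n ← applyUpTo⁻ (2 +_) (subst (Any _) (map-upTo (2 +_) n) (any⁻ _ _ t))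
  = 2 + i , s≤s (s≤s z≤n) , toWitness ii∣n

squareful-complete : ∀ n .{{_ : ℕ.NonZero n}} → HasSquareFactor n → T (squareful n)
squareful-complete n (zero        , ()        , _)
squareful-complete n (suc zero    , s≤s ()    , _)
squareful-complete n (suc (suc i) , _ , kk∣n) =
  any⁺ _ (subst (Any _) (sym (map-upTo (2 +_) n)) (applyUpTo⁺ (2 +_) (fromWitness kk∣n) i<n))
  where
  i<n : i < n
  i<n = ℕP.<-≤-trans (ℕP.m<n+m i {2} (s≤s z≤n)) (ℕP.≤-trans (ℕP.m≤m*n (2 + i) (2 + i)) (∣⇒≤ kk∣n))

T-ext : ∀ {x y} → (T x → T y) → (T y → T x) → x ≡ y
T-ext {false} {false} _  _  = refl
T-ext {false} {true}  _  y⇒x = ⊥-elim (y⇒x _)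
T-ext {true}  {false} x⇒y _  = ⊥-elim (x⇒y _)
T-ext {true}  {true}  _  _  = refl

prime-coprime : ∀ {p a} → Prime p → ¬ (p ∣ a) → Coprime a p
prime-coprime pp p∤a (i∣a , i∣p) with prime⇒irreducible pp i∣p
... | inj₁ i≡1   = i≡1
... | inj₂ refl  = ⊥-elim (p∤a i∣a)

squareful-* : ∀ {p j} → Prime p → ¬ (p ∣ j) → .{{_ : ℕ.NonZero j}} → squareful (p * j) ≡ squareful j
squareful-* {p} {j} pp p∤j = T-ext to from
  where
  instance
    _ = prime⇒nonZero pp
    _ = ℕP.m*n≢0 p j
  to : T (squareful (p * j)) → T (squareful j)
  to t with k , 2≤k , kk∣pj ← squareful-sound (p * j) t =
    squareful-complete j (k , 2≤k , coprime-divisor (prime-coprime pp p∤kk) kk∣pj)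
    where
    p∤kk : ¬ (p ∣ k * k)
    p∤kk p∣kk with euclidsLemma k k pp p∣kk
    ... | inj₁ p∣k = p∤j (*-cancelˡ-∣ p (∣-trans (*-pres-∣ p∣k p∣k) kk∣pj))
    ... | inj₂ p∣k = p∤j (*-cancelˡ-∣ p (∣-trans (*-pres-∣ p∣k p∣k) kk∣pj))
  from : T (squareful j) → T (squareful (p * j))
  from t with k , 2≤k , kk∣j ← squareful-sound j t =
    squareful-complete (p * j) (k , 2≤k , ∣-trans kk∣j (n∣m*n p))

μ-squareful : ∀ {p e} → Prime p → .{{_ : ℕ.NonZero e}} → p * p ∣ e → μ e ≡ ℤ.+ 0
μ-squareful {p@(suc (suc _))} {e} pp {{e≢0}} pp∣e
  rewrite μ-unfold e {{e≢0}}
  with squareful e | squareful-complete e {{e≢0}} (p , s≤s (s≤s z≤n) , pp∣e)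
... | true | _ = refl

primeDivisor? : ∀ n → Decidable (λ q → Prime q × q ∣ n)
primeDivisor? n q = prime? q ×-dec q ∣? n

ω-* : ∀ {p j} → Prime p → ¬ (p ∣ j) → .{{_ : ℕ.NonZero j}} → ω (p * j) ≡ suc (ω j)
ω-* {p} {j} pp p∤j = begin
  count (primeDivisor? (p * j)) (suc (p * j))
    ≡⟨ count-insert (primeDivisor? (p * j)) (primeDivisor? j) p (suc (p * j))
         (λ k _ → mk⇔ split unsplit) (p∤j ∘ proj₂) (s≤s (ℕP.m≤m*n p j)) ⟩
  suc (count (primeDivisor? j) (suc (p * j)))
    ≡⟨ cong suc (count-beyond (primeDivisor? j) (suc (p * j)) (s≤s (ℕP.m≤n*m j p)) too-large) ⟩
  suc (count (primeDivisor? j) (suc j)) ∎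
  where
  open ≡-Reasoning
  instance _ = prime⇒nonZero pp
  split : ∀ {k} → Prime k × k ∣ p * j → k ≡ p ⊎ (Prime k × k ∣ j)
  split (pk , k∣pj) with euclidsLemma p j pk k∣pj
  ... | inj₂ k∣j = inj₂ (pk , k∣j)
  ... | inj₁ k∣p with prime⇒irreducible pp k∣p
  ...   | inj₁ refl = ⊥-elim (¬prime[1] pk)
  ...   | inj₂ k≡p  = inj₁ k≡p
  unsplit : ∀ {k} → k ≡ p ⊎ (Prime k × k ∣ j) → Prime k × k ∣ p * j
  unsplit (inj₁ refl)       = pp , m∣m*n j
  unsplit (inj₂ (pk , k∣j)) = pk , ∣-trans k∣j (n∣m*n p)
  too-large : ∀ k → suc j ≤ k → ¬ (Prime k × k ∣ j)
  too-large k j<k (_ , k∣j) = ℕP.<⇒≱ j<k (∣⇒≤ k∣j)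

μ-* : ∀ {p j} → Prime p → ¬ (p ∣ j) → .{{_ : ℕ.NonZero j}} → μ (p * j) ≡ ℤ.- μ j
μ-* {p} {j} pp p∤j {{j≢0}}
  rewrite μ-unfold (p * j) {{ℕP.m*n≢0 p j {{prime⇒nonZero pp}}}} | μ-unfold j {{j≢0}}
        | squareful-* pp p∤j {{j≢0}} | ω-* pp p∤j {{j≢0}}
  with squareful j
... | true  = refl
... | false = refl

monomial-zero : ∀ a → monomial 0ℚ a ≃ []
monomial-zero a = coeffwise (go a)
  where
  go : ∀ a n → coeff (monomial 0ℚ a) n ≡ 0ℚ
  go zero    zero    = refl
  go zero    (suc n) = refl
  go (suc a) zero    = refl
  go (suc a) (suc n) = go a n

monomial-neg : ∀ c a → monomial (ℚ.- c) a ≃ neg (monomial c a)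
monomial-neg c a = coeffwise (go a)
  where
  go : ∀ a n → coeff (monomial (ℚ.- c) a) n ≡ coeff (neg (monomial c a)) n
  go zero    zero    = solve 1 (λ c → :- c := (:- con 1ℚ) :* c) refl c
  go zero    (suc n) = refl
  go (suc a) zero    = refl
  go (suc a) (suc n) = go a n

neg-/1 : ∀ z → (ℤ.- z) ℚ./ 1 ≡ ℚ.- (z ℚ./ 1)
neg-/1 (ℤ.+ zero)  = refl
neg-/1 (ℤ.+ suc n) = refl
neg-/1 ℤ.-[1+ n ]  = solve 1 (λ x → x := :- (:- x)) refl (ℤ.+ suc n ℚ./ 1)

necklaceTerm-∣ : ∀ d {k E} .{{_ : ℕ.NonZero E}} → suc k ≡ E → E ∣ d →
  necklaceTerm d k ≡ monomial (μ E ℚ./ 1) (d / E)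
necklaceTerm-∣ d {k} refl E∣d with suc k ∣? d
... | yes _   = refl
... | no E∤d  = ⊥-elim (E∤d E∣d)

necklaceTerm-∤ : ∀ d {k E} → suc k ≡ E → ¬ (E ∣ d) → necklaceTerm d k ≡ []
necklaceTerm-∤ d {k} refl E∤d with suc k ∣? d
... | yes E∣d = ⊥-elim (E∤d E∣d)
... | no _    = refl

arith-ape : ∀ a e p → (a * e) * p ≡ (a * p) * e
arith-ape = solve-∀

arith-ape′ : ∀ a e p → (a * e) * p ≡ a * (p * e)
arith-ape′ = solve-∀

arith-period : ∀ a t m → a * suc (t * m) ≡ a + m * (a * t)
arith-period = solve-∀

-- Let p = q + 1 be a prime with m ∣ q, and d = d′·p.  Modulo
-- x^m - 1 the summands of d·M_d cancel in pairs: for p ∤ e the summand for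
-- p·e is -μ(e)·x^{d/(pe)} ≡ -μ(e)·x^{d/e} (as p ≡ 1 mod m), while for p ∣ e
-- it vanishes since p² ∣ p·e.  The summands for p ∤ e have e ∣ d′.

module CancellingPairs (m q d′ : ℕ) .{{_ : ℕ.NonZero d′}} (pp : Prime (suc q)) (m∣q : m ∣ q) where

  p d : ℕ
  p = suc q
  d = d′ * p

  open ModuloXPowMinusOne m
  open RangeSum ≋-commutativeMonoid
  open CommutativeMonoid ≋-commutativeMonoid using (setoid; reflexive; ∙-cong; ∙-congʳ)
  open import Relation.Binary.Reasoning.Setoid setoid

  term : ℕ → Poly
  term = necklaceTerm d

  coprimeTerm : ℕ → Poly
  coprimeTerm k = unless (p ∣? suc k) (term k)

  index-pe : ∀ j → suc (j * p + q) ≡ p * suc j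
  index-pe j = trans (cong suc (ℕP.+-comm (j * p) q)) (ℕP.*-comm (suc j) p)

  instance _ = prime⇒nonZero pp

  -- The summand for p·e when p ∣ e: μ(p·e) = 0.
  cancel-p∣e : ∀ j → p ∣ suc j → term (j * p + q) +ᴾ coprimeTerm j ≋ []
  cancel-p∣e j p∣e rewrite unless-yes (p ∣? suc j) {term j} p∣e =
    ≃⇒≋ (≃-trans (P.identityʳ _) (vanish (p * suc j ∣? d)))
    where
    module P = CommutativeMonoid +ᴾ-commutativeMonoid
    instance _ = ℕP.m*n≢0 p (suc j)
    vanish : Dec (p * suc j ∣ d) → term (j * p + q) ≃ []
    vanish (yes E∣d)
      rewrite necklaceTerm-∣ d (index-pe j) E∣d | μ-squareful pp (*-pres-∣ (∣-refl {p}) p∣e)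
      = monomial-zero _
    vanish (no E∤d) rewrite necklaceTerm-∤ d (index-pe j) E∤d = ≃-refl

  cancel-e∤d : ∀ j → ¬ (p ∣ suc j) → ¬ (suc j ∣ d) → term (j * p + q) +ᴾ coprimeTerm j ≋ []
  cancel-e∤d j p∤e e∤d
    rewrite unless-no (p ∣? suc j) {term j} p∤e | necklaceTerm-∤ d refl e∤d
          | necklaceTerm-∤ d (index-pe j) (e∤d ∘ ∣-trans (n∣m*n p))
    = ≃⇒≋ ≃-refl

  -- The summands for e and p·e when p ∤ e and e ∣ d, say d′ = a·e: they are
  -- -μ(e)·x^a and μ(e)·x^{a·p}, and a·p ≡ a (mod m).
  cancel-e∣d : ∀ j → ¬ (p ∣ suc j) → suc j ∣ d → term (j * p + q) +ᴾ coprimeTerm j ≋ []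
  cancel-e∣d j p∤e e∣d
    with divides a d′≡ae ← coprime-divisor (prime-coprime pp p∤e) (subst (suc j ∣_) (ℕP.*-comm d′ p) e∣d)
    = begin
      term (j * p + q) +ᴾ coprimeTerm j                 ≡⟨ cong₂ _+ᴾ_ T[pe]≡ T[e]≡ ⟩
      monomial (ℚ.- c) a +ᴾ monomial c (a * p)       ≈⟨ ≋-+ (≃⇒≋ (monomial-neg c a)) ap≡a ⟩
      neg (monomial c a) +ᴾ monomial c a             ≈⟨ ≃⇒≋ (neg-+ᴾ-cancel (monomial c a)) ⟩
      []                                             ∎
    where
    e = suc j
    c = μ e ℚ./ 1
    instance _ = ℕP.m*n≢0 p e
    d≡[ap]e : d ≡ (a * p) * e
    d≡[ap]e = trans (cong (_* p) d′≡ae) (arith-ape a e p)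
    d≡a[pe] : d ≡ a * (p * e)
    d≡a[pe] = trans (cong (_* p) d′≡ae) (arith-ape′ a e p)
    T[e]≡ : coprimeTerm j ≡ monomial c (a * p)
    T[e]≡ = trans (unless-no (p ∣? suc j) p∤e)
      (trans (necklaceTerm-∣ d refl e∣d) (cong (monomial c) (trans (cong (_/ e) d≡[ap]e) (m*n/n≡m (a * p) e))))
    T[pe]≡ : term (j * p + q) ≡ monomial (ℚ.- c) a
    T[pe]≡ = trans (necklaceTerm-∣ d (index-pe j) (subst (p * e ∣_) (sym d≡a[pe]) (n∣m*n a)))
      (cong₂ monomial (trans (cong (ℚ._/ 1) (μ-* pp p∤e)) (neg-/1 (μ e)))
                      (trans (cong (_/ (p * e)) d≡a[pe]) (m*n/n≡m a (p * e))))
    open _∣_ m∣q renaming (quotient to t; equality to q≡tm)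
    ap≡a : monomial c (a * p) ≋ monomial c a
    ap≡a = subst (λ b → monomial c b ≋ monomial c a)
      (sym (trans (cong (λ q → a * suc q) q≡tm) (arith-period a t m))) (monomial-period-≋ c a (a * t))

  pair-cancels : ∀ j → term (j * p + q) +ᴾ coprimeTerm j ≋ []
  pair-cancels j = by-cases (p ∣? suc j) (suc j ∣? d)
    where
    by-cases : Dec (p ∣ suc j) → Dec (suc j ∣ d) → term (j * p + q) +ᴾ coprimeTerm j ≋ []
    by-cases (yes p∣e) _         = cancel-p∣e j p∣e
    by-cases (no p∤e)  (no e∤d)  = cancel-e∤d j p∤e e∤d
    by-cases (no p∤e)  (yes e∣d) = cancel-e∣d j p∤e e∣d

  -- Summands for e prime to p with e > d′ vanish, since such e divide d′.
  coprimeTerm-beyond : ∀ k → d′ ≤ k → coprimeTerm k ≋ []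
  coprimeTerm-beyond k d′≤k = ≃⇒≋ (by-cases (p ∣? suc k))
    where
    by-cases : (p∣e? : Dec (p ∣ suc k)) → unless p∣e? (term k) ≃ []
    by-cases (yes _)  = ≃-refl
    by-cases (no p∤e) with suc k ∣? d
    ... | no e∤d  = ≃-refl
    ... | yes e∣d = ⊥-elim (ℕP.<⇒≱ (s≤s d′≤k)
          (∣⇒≤ (coprime-divisor (prime-coprime pp p∤e) (subst (suc k ∣_) (ℕP.*-comm d′ p) e∣d))))

  Σ-cancels : Σ< d term ≋ []
  Σ-cancels = begin
    Σ< d term
      ≈⟨ Σ<-partition (λ k → p ∣? suc k) d term ⟩
    Σ< d (λ k → when (p ∣? suc k) (term k)) +ᴾ Σ< d coprimeTerm
      ≈⟨ ∙-cong (Σ<-multiples q d′ _ (λ k p∤ → reflexive (when-no (p ∣? suc k) p∤)))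
                (Σ<-truncate coprimeTerm (ℕP.m≤m*n d′ p) coprimeTerm-beyond) ⟩
    Σ< d′ (λ j → when (p ∣? suc (j * p + q)) (term (j * p + q))) +ᴾ Σ< d′ coprimeTerm
      ≈⟨ ∙-congʳ (Σ<-cong d′ (λ j _ → reflexive
           (when-yes (p ∣? suc (j * p + q)) (subst (p ∣_) (sym (index-pe j)) (m∣m*n (suc j)))))) ⟩
    Σ< d′ (λ j → term (j * p + q)) +ᴾ Σ< d′ coprimeTerm
      ≈⟨ ≋-sym (Σ<-∙ d′ _ _) ⟩
    Σ< d′ (λ j → term (j * p + q) +ᴾ coprimeTerm j)
      ≈⟨ Σ<-ε d′ (λ j _ → pair-cancels j) ⟩
    [] ∎

necklace≡ : ∀ n → necklace (suc n) ≡ scaleᴾ (ℤ.+ 1 ℚ./ suc n) (RangeSum.Σ< +ᴾ-commutativeMonoid (suc n) (necklaceTerm (suc n)))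
necklace≡ n = cong (scaleᴾ (ℤ.+ 1 ℚ./ suc n) ∘ foldr _+ᴾ_ []) (map-upTo (necklaceTerm (suc n)) (suc n))

necklace-divisible : ∀ m d p → Prime p → p ∣ d → m ∣ p ∸ 1 → xPowMinusOne m ∣ᴾ necklace d
necklace-divisible m zero    p        pp p∣d m∣p-1 = [] , at (*ᴾ-zeroʳ (xPowMinusOne m))
necklace-divisible m d@(suc n) (suc q) pp (divides d′ d≡d′p) m∣q
  rewrite necklace≡ n = ≋-zero⇒∣ᴾ (≋-scale (ℤ.+ 1 ℚ./ d) (subst (λ d → RangeSum.Σ< ≋-commutativeMonoid d (necklaceTerm d) ≋ []) (sym d≡d′p) Σ-cancels))
  where
  open ModuloXPowMinusOne m
  instance
    _ : ℕ.NonZero d′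
    _ = ℕP.m*n≢0⇒m≢0 d′ {{subst ℕ.NonZero d≡d′p _}}
  open CancellingPairs m q d′ pp m∣q using (Σ-cancels)

-- For an
-- m-periodic w this linear functional vanishes on the multiples of x^m - 1,
-- which yields the obstructions used in part (2).

pairing : (ℕ → ℚ) → Poly → ℚ
pairing w []      = 0ℚ
pairing w (a ∷ f) = w 0 ℚ.* a ℚ.+ pairing (w ∘ suc) f

pairing-weights : ∀ {w w′} f → (∀ n → w n ≡ w′ n) → pairing w f ≡ pairing w′ f
pairing-weights []      w≡w′ = refl
pairing-weights (a ∷ f) w≡w′ = cong₂ ℚ._+_ (cong (ℚ._* a) (w≡w′ 0)) (pairing-weights f (w≡w′ ∘ suc))

pairing-+ : ∀ w f h → pairing w (f +ᴾ h) ≡ pairing w f ℚ.+ pairing w h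
pairing-+ w []      h       = sym (ℚP.+-identityˡ _)
pairing-+ w (a ∷ f) []      = sym (ℚP.+-identityʳ _)
pairing-+ w (a ∷ f) (b ∷ h) rewrite pairing-+ (w ∘ suc) f h =
  solve 5 (λ w₀ a b x y → w₀ :* (a :+ b) :+ (x :+ y) := (w₀ :* a :+ x) :+ (w₀ :* b :+ y))
        refl (w 0) a b (pairing (w ∘ suc) f) (pairing (w ∘ suc) h)

pairing-scale : ∀ w c f → pairing w (scaleᴾ c f) ≡ c ℚ.* pairing w f
pairing-scale w c []      = sym (ℚP.*-zeroʳ c)
pairing-scale w c (a ∷ f) rewrite pairing-scale (w ∘ suc) c f =
  solve 4 (λ w₀ c a x → w₀ :* (c :* a) :+ c :* x := c :* (w₀ :* a :+ x))
        refl (w 0) c a (pairing (w ∘ suc) f)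

pairing-shift : ∀ w k r → pairing w (shiftᴾ k r) ≡ pairing (λ n → w (k + n)) r
pairing-shift w zero    r = refl
pairing-shift w (suc k) r =
  trans (cong (ℚ._+ pairing (w ∘ suc) (shiftᴾ k r)) (ℚP.*-zeroʳ (w 0)))
        (trans (ℚP.+-identityˡ _) (pairing-shift (w ∘ suc) k r))

pairing-monomial : ∀ w c k → pairing w (monomial c k) ≡ w k ℚ.* c
pairing-monomial w c k =
  trans (pairing-shift w k [ c ]) (trans (ℚP.+-identityʳ _) (cong (λ n → w n ℚ.* c) (ℕP.+-identityʳ k)))

pairing-zero : ∀ w {f} → f ≃ [] → pairing w f ≡ 0ℚ
pairing-zero w {[]}    f≃0 = refl
pairing-zero w {a ∷ f} f≃0 =
  trans (cong₂ (λ a x → w 0 ℚ.* a ℚ.+ x) (at f≃0 0) (pairing-zero (w ∘ suc) {f} (coeffwise (at f≃0 ∘ suc))))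
        (solve 1 (λ w₀ → w₀ :* con 0ℚ :+ con 0ℚ := con 0ℚ) refl (w 0))

pairing-≃ : ∀ w {f h} → f ≃ h → pairing w f ≡ pairing w h
pairing-≃ w {[]}    {[]}    f≃h = refl
pairing-≃ w {[]}    {b ∷ h} f≃h = sym (pairing-zero w (≃-sym f≃h))
pairing-≃ w {a ∷ f} {[]}    f≃h = pairing-zero w f≃h
pairing-≃ w {a ∷ f} {b ∷ h} f≃h =
  cong₂ (λ a x → w 0 ℚ.* a ℚ.+ x) (at f≃h 0) (pairing-≃ (w ∘ suc) {f} {h} (coeffwise (at f≃h ∘ suc)))

Periodic : ℕ → (ℕ → ℚ) → Set
Periodic m w = ∀ n → w (m + n) ≡ w n

pairing-divisible : ∀ m w f → Periodic m w → xPowMinusOne m ∣ᴾ f → pairing w f ≡ 0ℚ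
pairing-divisible m w f periodic (r , gr≈f) = begin
  pairing w f                                     ≡⟨ pairing-≃ w (≃-sym (≃-trans (≃-sym (xPowMinusOne-*ᴾ m r)) (coeffwise {q = f} gr≈f))) ⟩
  pairing w (shiftᴾ m r -ᴾ r)                     ≡⟨ pairing-+ w (shiftᴾ m r) (neg r) ⟩
  pairing w (shiftᴾ m r) ℚ.+ pairing w (neg r)    ≡⟨ cong₂ ℚ._+_ (trans (pairing-shift w m r) (pairing-weights r periodic))
                                                                  (pairing-scale w (ℚ.- 1ℚ) r) ⟩
  pairing w r ℚ.+ ℚ.- 1ℚ ℚ.* pairing w r          ≡⟨ solve 1 (λ x → x :+ (:- con 1ℚ) :* x := con 0ℚ) refl (pairing w r) ⟩
  0ℚ                                              ∎
  where open ≡-Reasoning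

-- μ(p) = -1, from μ(p·1) = -μ(1).
μ-prime : ∀ {p} → Prime p → μ p ≡ ℤ.-[1+ 0 ]
μ-prime {p@(suc (suc _))} pp = trans (cong μ (sym (ℕP.*-identityʳ p))) (μ-* pp p∤1)
  where
  p∤1 : ¬ (p ∣ 1)
  p∤1 p∣1 with ∣⇒≤ p∣1
  ... | s≤s ()

necklace-prime : ∀ r → Prime (suc (suc r)) →
  necklace (suc (suc r)) ≃ scaleᴾ (ℤ.+ 1 ℚ./ suc (suc r)) (monomial 1ℚ (suc (suc r)) +ᴾ monomial (ℚ.- 1ℚ) 1)
necklace-prime r pp rewrite necklace≡ (suc r) = scaleᴾ-cong (ℤ.+ 1 ℚ./ p) (begin
  term 0 +ᴾ Σ< (suc r) (term ∘ suc)                ≈⟨ ∙-congˡ {term 0} (Σ<-last r (term ∘ suc)) ⟩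
  term 0 +ᴾ (Σ< r (term ∘ suc) +ᴾ term (suc r))    ≈⟨ ∙-congˡ {term 0} (∙-congʳ {term (suc r)} (Σ<-ε r middle)) ⟩
  term 0 +ᴾ ([] +ᴾ term (suc r))                   ≡⟨ cong₂ _+ᴾ_ first last ⟩
  monomial 1ℚ p +ᴾ monomial (ℚ.- 1ℚ) 1            ∎)
  where
  p = suc (suc r)
  term = necklaceTerm p
  open RangeSum +ᴾ-commutativeMonoid
  open CommutativeMonoid +ᴾ-commutativeMonoid using (setoid; ∙-congˡ; ∙-congʳ)
  open import Relation.Binary.Reasoning.Setoid setoid
  first : term 0 ≡ monomial 1ℚ p
  first = trans (necklaceTerm-∣ p refl (1∣ p)) (cong (monomial 1ℚ) (n/1≡n p))
  last : term (suc r) ≡ monomial (ℚ.- 1ℚ) 1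
  last = trans (necklaceTerm-∣ p refl ∣-refl) (cong₂ monomial (cong (ℚ._/ 1) (μ-prime pp)) (n/n≡1 p))
  k+2∤p : ∀ {k} → k < r → ¬ (suc (suc k) ∣ p)
  k+2∤p k<r k+2∣p with prime⇒irreducible pp k+2∣p
  ... | inj₂ k+2≡p = ℕP.<⇒≢ (s≤s (s≤s k<r)) k+2≡p
  middle : ∀ k → k < r → term (suc k) ≃ []
  middle k k<r rewrite necklaceTerm-∤ p refl (k+2∤p k<r) = ≃-refl

1/n≢0 : ∀ n .{{_ : ℕ.NonZero n}} → ℤ.+ 1 ℚ./ n ≢ 0ℚ
1/n≢0 n 1/n≡0 with subst ℚ.Positive 1/n≡0 (ℚP.normalize-pos 1 n)
... | ()

χ : ∀ {A : Set} → Dec A → ℚ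
χ (yes _) = 1ℚ
χ (no _)  = 0ℚ

χ-yes : ∀ {A : Set} (a? : Dec A) → A → χ a? ≡ 1ℚ
χ-yes (yes _) _ = refl
χ-yes (no ¬a) a = ⊥-elim (¬a a)

χ-no : ∀ {A : Set} (a? : Dec A) → ¬ A → χ a? ≡ 0ℚ
χ-no (yes a) ¬a = ⊥-elim (¬a a)
χ-no (no _)  _  = refl

χ-cong : ∀ {A B : Set} → A ⇔ B → (a? : Dec A) (b? : Dec B) → χ a? ≡ χ b?
χ-cong A⇔B (yes a) b? = sym (χ-yes b? (Equivalence.to A⇔B a))
χ-cong A⇔B (no ¬a) b? = sym (χ-no b? (¬a ∘ Equivalence.from A⇔B))

-- The indicator of the residue class n ≡ 1 modulo m′ + 1.
residue-one : ℕ → ℕ → ℚ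
residue-one m′ n = χ (suc m′ ∣? n + m′)

residue-one-periodic : ∀ m′ → Periodic (suc m′) (residue-one m′)
residue-one-periodic m′ n = χ-cong (mk⇔ drop add) (suc m′ ∣? (suc m′ + n) + m′) (suc m′ ∣? n + m′)
  where
  reassoc : (suc m′ + n) + m′ ≡ suc m′ + (n + m′)
  reassoc = ℕP.+-assoc (suc m′) n m′
  drop : suc m′ ∣ (suc m′ + n) + m′ → suc m′ ∣ n + m′
  drop m∣ = ∣m+n∣m⇒∣n (subst (suc m′ ∣_) reassoc m∣) ∣-refl
  add : suc m′ ∣ n + m′ → suc m′ ∣ (suc m′ + n) + m′
  add m∣ = subst (suc m′ ∣_) (sym reassoc) (∣m∣n⇒∣m+n ∣-refl m∣)

-- Pair M_p = (x^p - x)/p with the indicator w of n ≡ 1 (mod m):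
-- 0 = (w(p) - w(1))/p = (w(p) - 1)/p forces w(p) = 1.  (Prime 0 and Prime 1
-- are empty types, so only p ≥ 2 needs a clause.)
necklace-prime-divisible⇒ : ∀ m′ p → Prime p → xPowMinusOne (suc m′) ∣ᴾ necklace p → suc m′ ∣ p ∸ 1
necklace-prime-divisible⇒ m′ (suc (suc r)) pp g∣Mₚ = decide (suc m′ ∣? p + m′)
  where
  p = suc (suc r)
  c = ℤ.+ 1 ℚ./ p
  w = residue-one m′
  pairing-Mₚ : c ℚ.* (w p ℚ.* 1ℚ ℚ.+ w 1 ℚ.* ℚ.- 1ℚ) ≡ 0ℚ
  pairing-Mₚ = begin
    c ℚ.* (w p ℚ.* 1ℚ ℚ.+ w 1 ℚ.* ℚ.- 1ℚ)
      ≡⟨ sym (trans (pairing-scale w c (monomial 1ℚ p +ᴾ monomial (ℚ.- 1ℚ) 1))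
                    (cong (c ℚ.*_) (trans (pairing-+ w (monomial 1ℚ p) (monomial (ℚ.- 1ℚ) 1))
                                          (cong₂ ℚ._+_ (pairing-monomial w 1ℚ p) (pairing-monomial w (ℚ.- 1ℚ) 1))))) ⟩
    pairing w (scaleᴾ c (monomial 1ℚ p +ᴾ monomial (ℚ.- 1ℚ) 1))
      ≡⟨ sym (pairing-≃ w (necklace-prime r pp)) ⟩
    pairing w (necklace p)
      ≡⟨ pairing-divisible (suc m′) w (necklace p) (residue-one-periodic m′) g∣Mₚ ⟩
    0ℚ ∎
    where open ≡-Reasoning
  decide : Dec (suc m′ ∣ p + m′) → suc m′ ∣ suc r
  decide (yes m∣p+m′) = ∣m+n∣m⇒∣n (subst (suc m′ ∣_) (cong suc (ℕP.+-comm (suc r) m′)) m∣p+m′) ∣-refl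
  decide (no m∤p+m′)  = ⊥-elim (1/n≢0 p (begin
    c                                                   ≡⟨ solve 1 (λ c → c := :- (c :* (con 0ℚ :* con 1ℚ :+ con 1ℚ :* (:- con 1ℚ)))) refl c ⟩
    ℚ.- (c ℚ.* (0ℚ ℚ.* 1ℚ ℚ.+ 1ℚ ℚ.* ℚ.- 1ℚ))          ≡⟨ cong₂ (λ u v → ℚ.- (c ℚ.* (u ℚ.* 1ℚ ℚ.+ v ℚ.* ℚ.- 1ℚ)))
                                                              (sym (χ-no (suc m′ ∣? p + m′) m∤p+m′)) (sym (χ-yes (suc m′ ∣? 1 + m′) ∣-refl)) ⟩
    ℚ.- (c ℚ.* (w p ℚ.* 1ℚ ℚ.+ w 1 ℚ.* ℚ.- 1ℚ))        ≡⟨ cong ℚ.-_ pairing-Mₚ ⟩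
    0ℚ                                                  ∎))
    where open ≡-Reasoning

-- M_1 = x is not divisible by x^m - 1: its pairing with the constant weight 1 is 1.
¬divides-necklace₁ : ∀ m → ¬ (xPowMinusOne m ∣ᴾ necklace 1)
¬divides-necklace₁ m g∣M₁ with pairing-divisible m (λ _ → 1ℚ) (necklace 1) (λ _ → refl) g∣M₁
... | ()

prime-minimally-divides : ∀ m′ p → Prime p → MinDivides (suc m′) p ⇔ suc m′ ∣ p ∸ 1
prime-minimally-divides m′ p pp = mk⇔ (necklace-prime-divisible⇒ m′ p pp ∘ proj₁)
  (λ m∣p-1 → necklace-divisible (suc m′) p p pp ∣-refl m∣p-1 , only-1-below)
  where
  only-1-below : ∀ e → e ∣ p → e ≢ p → ¬ (xPowMinusOne (suc m′) ∣ᴾ necklace e)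
  only-1-below e e∣p e≢p with prime⇒irreducible pp e∣p
  ... | inj₁ refl = ¬divides-necklace₁ (suc m′)
  ... | inj₂ e≡p  = ⊥-elim (e≢p e≡p)

proposition2p16 : (m d : ℕ) → 1 ≤ m → 1 ≤ d →
    ((∃ λ p → Prime p × p ∣ d × m ∣ p ∸ 1) → xPowMinusOne m ∣ᴾ necklace d)
    × ((p : ℕ) → Prime p → (MinDivides m p ⇔ m ∣ p ∸ 1))
proposition2p16 (suc m′) d _ _ =
  (λ (p , pp , p∣d , m∣p-1) → necklace-divisible (suc m′) d p pp p∣d m∣p-1) ,
  prime-minimally-divides m′
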